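{- $\vDash_{\mathsf{PI}}\Box\forall x,y,z\in\mathbb{N}\,((Sxy\wedge Sxz)\rightarrow y=z)$.
   Context: PI model: $\mathcal{M}=\langle W,R,D,I\rangle$ with $W$ countably infinite, $R$ a directed partial order (reflexive, transitive, antisymmetric, any two worlds have a common successor), each $D(w)$ non-empty finite, $n$-ary second-order quantifiers at $w$ range over all subsets of $D(w)^n$, $D(w)\subsetneq D(s)$ whenever $R(w,s)$, $w\ne s$, and an injection $\mathbf{a}:\omega\to\bigcup_wD(w)$ with $\#X=\mathbf{a}_{|X|}$ at every world for all $X\subseteq D(s)$, $s\in W$. Kripke semantics: actualist first-order quantifiers over $D(w)$, free variables may denote any object of the model, rigid set variables, $\Box$ over $R$-successors. $\vDash_{\mathsf{PI}}\varphi$: $\varphi$ true at every world of every PI model under every assignment. Definitions: $0:=\#\varnothing$; $Sxy:\equiv\Diamond\exists G\exists u[Gu\wedge y=\#G\wedge x=\#(G\setminus\{u\})]$; strong ancestral $S^+(a,b):\equiv\forall X[(\forall x,y(Xx\wedge Sxy\rightarrow Xy)\wedge\forall x(Sax\rightarrow Xx))\rightarrow Xb]$; $S^{+=}(a,b):\equiv S^+(a,b)\vee a=b$; $\mathbb{N}x:\equiv S^{+=}(0,x)\wedge\exists y(y=0)$; $\forall x\in\mathbb{N}\,\varphi$ abbreviates $\forall x(\mathbb{N}x\rightarrow\varphi)$ and $\exists x\in\mathbb{N}\,\varphi$ abbreviates $\exists x(\mathbb{N}x\wedge\varphi)$. -}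

module Defs where

open import Level using (0ℓ)
open import Data.Nat using (ℕ; zero; suc)
open import Data.Bool using (Bool; true; false; T)
open import Data.List using (List; []; length; filterᵇ)
open import Data.List.Membership.Propositional using (_∈_; _∉_)
open import Data.List.Relation.Unary.Unique.Propositional using (Unique)
open import Data.Product using (Σ; ∃; _×_; _,_)
open import Data.Sum using (_⊎_)
open import Data.Empty using (⊥)
open import Relation.Nullary using (¬_)
open import Relation.Binary.PropositionalEquality using (_≡_; _≢_)
open import Function.Bundles using (_↔_)
open import Function.Definitions using (Injective)

-- Subsets of D w (the range of monadic second-order quantifiers at w) are
-- represented as Bool-valued predicates on Obj that are false outside D w.
-- The cardinality operator # is interpreted as  #X = a_|X| , via the
-- injection a : ℕ → ⋃_w D w.
record PIModel : Set₁ where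
  field
    W        : Set
    W-count  : W ↔ ℕ
    R        : W → W → Set
    R-refl   : ∀ w → R w w
    R-trans  : ∀ {w s t} → R w s → R s t → R w t
    R-antisym : ∀ {w s} → R w s → R s w → w ≡ s
    R-directed : ∀ w s → ∃ λ t → R w t × R s t
    Obj      : Set
    D        : W → List Obj
    D-unique : ∀ w → Unique (D w)
    D-nonempty : ∀ w → D w ≢ []
    D-strict : ∀ {w s} → R w s → w ≢ s →
               (∀ {o} → o ∈ D w → o ∈ D s) × (∃ λ o → o ∈ D s × o ∉ D w)
    a        : ℕ → Obj
    a-inj    : Injective _≡_ _≡_ a
    a-range  : ∀ n → ∃ λ w → a n ∈ D w

module Sem (M : PIModel) where
  open PIModel M

  IsSubset : W → (Obj → Bool) → Set
  IsSubset w X = ∀ o → T (X o) → o ∈ D w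

  card : W → (Obj → Bool) → ℕ
  card w X = length (filterᵇ X (D w))

  num : W → (Obj → Bool) → Obj
  num w X = a (card w X)

  -- 0 := #∅
  zeroO : Obj
  zeroO = a 0

  -- truth of  S x y  at world w:
  -- ◇ ∃G ∃u [ G u ∧ y = #G ∧ x = #(G ∖ {u}) ]
  -- (H below is the subset G ∖ {u})
  Succ : W → Obj → Obj → Set
  Succ w x y =
    ∃ λ s → R w s ×
      Σ (Obj → Bool) λ G → IsSubset s G ×
      Σ Obj λ u → u ∈ D s × T (G u) ×
      y ≡ num s G ×
      Σ (Obj → Bool) λ H → (∀ o → T (H o) → (T (G o) × o ≢ u)) ×
                           (∀ o → T (G o) → o ≢ u → T (H o)) ×
                           x ≡ num s H

  SuccPlus : W → Obj → Obj → Set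
  SuccPlus w b c =
    (X : Obj → Bool) → IsSubset w X →
    (∀ x y → x ∈ D w → y ∈ D w → T (X x) → Succ w x y → T (X y)) →
    (∀ x → x ∈ D w → Succ w b x → T (X x)) →
    T (X c)

  SuccPlusEq : W → Obj → Obj → Set
  SuccPlusEq w b c = SuccPlus w b c ⊎ b ≡ c

  Nat : W → Obj → Set
  Nat w x = SuccPlusEq w zeroO x × (∃ λ y → y ∈ D w × y ≡ zeroO)

-- Whenever S x y holds, the witnesses G and G ∖ {u} live in one finite domain, where u is
-- counted by G and not by G ∖ {u}; hence x = a_n and y = a_(n+1) for n = |G ∖ {u}|.
-- Injectivity of a then determines n from x, and with it y.
module Submission where

open import Defs
open import Data.Bool using (Bool; true; false; T)
open import Data.Bool.Properties using (T-≡)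
open import Data.Empty using (⊥-elim)
open import Data.List using (List; []; _∷_; length; filterᵇ)
open import Data.List.Membership.Propositional using (_∈_)
open import Data.List.Relation.Unary.Any using (here; there)
open import Data.List.Relation.Unary.All.Properties using (All¬⇒¬Any)
open import Data.List.Relation.Unary.AllPairs using (_∷_)
open import Data.List.Relation.Unary.Unique.Propositional using (Unique)
open import Data.Nat using (suc)
open import Data.Product using (∃; _×_; _,_; proj₁; proj₂)
open import Data.Unit using (tt)
open import Function using (_∘′_; Equivalence)
open import Relation.Binary.PropositionalEquality using (_≡_; _≢_; refl; sym; trans; cong; module ≡-Reasoning)
open PIModel
open Sem

module _ {A : Set} {G H : A → Bool} {u : A}
  (H⇒G∖u : ∀ o → T (H o) → T (G o) × o ≢ u)
  (G∖u⇒H : ∀ o → T (G o) → o ≢ u → T (H o)) where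

  removal-agrees : ∀ o → o ≢ u → G o ≡ H o
  removal-agrees o o≢u with G o | H o | H⇒G∖u o | G∖u⇒H o
  ... | true  | true  | _ | _ = refl
  ... | false | false | _ | _ = refl
  ... | true  | false | _ | G⇒H = ⊥-elim (G⇒H tt o≢u)
  ... | false | true  | H⇒G | _ = ⊥-elim (proj₁ (H⇒G tt))

  removal-drops : H u ≡ false
  removal-drops with H u | H⇒G∖u u
  ... | true  | H⇒G = ⊥-elim (proj₂ (H⇒G tt) refl)
  ... | false | _   = refl

filterᵇ-cong-∈ : ∀ {A : Set} {G H : A → Bool} (L : List A) →
                 (∀ {o} → o ∈ L → G o ≡ H o) → filterᵇ G L ≡ filterᵇ H L
filterᵇ-cong-∈ [] _ = refl
filterᵇ-cong-∈ {G = G} {H} (o ∷ L) agree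
  with ih ← filterᵇ-cong-∈ L (λ o∈L → agree (there o∈L))
     | G o | H o | agree (here refl)
... | true  | .true  | refl = cong (o ∷_) ih
... | false | .false | refl = ih

length-filterᵇ-remove : ∀ {A : Set} {G H : A → Bool} {u : A} {L : List A} →
  Unique L → u ∈ L → G u ≡ true → H u ≡ false → (∀ o → o ≢ u → G o ≡ H o) →
  length (filterᵇ G L) ≡ suc (length (filterᵇ H L))
length-filterᵇ-remove {L = u ∷ L} (u∉L ∷ _) (here refl) Gu Hu agree
  rewrite Gu | Hu =
  cong (suc ∘′ length) (filterᵇ-cong-∈ L λ {o} o∈L → agree o λ { refl → All¬⇒¬Any u∉L o∈L })
length-filterᵇ-remove {G = G} {H} {L = o ∷ L} (o∉L ∷ uniq) (there u∈L) Gu Hu agree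
  with ih ← length-filterᵇ-remove uniq u∈L Gu Hu agree
     | G o | H o | agree o (λ { refl → All¬⇒¬Any o∉L u∈L })
... | true  | .true  | refl = cong suc ih
... | false | .false | refl = ih

module _ (M : PIModel) where
  Succ⇒consecutive : ∀ {w x y} → Succ M w x y → ∃ λ n → x ≡ a M n × y ≡ a M (suc n)
  Succ⇒consecutive (s , _ , G , _ , u , u∈Ds , Gu , y≡#G , H , H⇒G∖u , G∖u⇒H , x≡#H) =
    card M s H , x≡#H , trans y≡#G (cong (a M) |G|≡1+|H|)
    where
      |G|≡1+|H| : card M s G ≡ suc (card M s H)
      |G|≡1+|H| = length-filterᵇ-remove (D-unique M s) u∈Ds (Equivalence.to T-≡ Gu)
        (removal-drops H⇒G∖u G∖u⇒H) (removal-agrees H⇒G∖u G∖u⇒H)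

  Succ-functional : ∀ {w x y z} → Succ M w x y → Succ M w x z → y ≡ z
  Succ-functional {y = y} {z = z} Sxy Sxz with Succ⇒consecutive Sxy | Succ⇒consecutive Sxz
  ... | n , x≡aₙ , y≡aₙ₊₁ | m , x≡aₘ , z≡aₘ₊₁ = begin
    y             ≡⟨ y≡aₙ₊₁ ⟩
    a M (suc n)   ≡⟨ cong (a M ∘′ suc) (a-inj M (trans (sym x≡aₙ) x≡aₘ)) ⟩
    a M (suc m)   ≡⟨ sym z≡aₘ₊₁ ⟩
    z             ∎
    where open ≡-Reasoning

lemma7 : (M : PIModel) →
    ∀ w s → R M w s →
    ∀ x y z → x ∈ D M s → y ∈ D M s → z ∈ D M s →
    Nat M s x → Nat M s y → Nat M s z →
    Succ M s x y × Succ M s x z → y ≡ z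
lemma7 M _ _ _ _ _ _ _ _ _ _ _ _ (Sxy , Sxz) = Succ-functional M Sxy Sxz
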